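{- Let $H$ be a connected imperfect graph with no induced $K_3$ and no induced $P_2\cup P_3$, with the setup of the context. Suppose $B_i,B_{i+2}\ne\emptyset$ for some $i$. If $A_i\cup A_{i+2}\ne\emptyset$, or $A_{i-2}\ne\emptyset$ and $A_{i-1}\ne\emptyset$, then $|B_i|=|B_{i+2}|=1$.
   Context: $P_2\cup P_3$ is the disjoint union of a path on 2 vertices and a path on 3 vertices. Such $H$ contains an induced 5-cycle. Setup: fix an induced 5-cycle with vertices $v_1,\dots,v_5$ in cyclic order, indices mod 5, $S_0=\{v_1,\dots,v_5\}$; $S_1$ is the set of vertices outside $S_0$ having a neighbor in $S_0$; $A_i=\{x\in S_1:N(x)\cap S_0=\{v_i\}\}$, $B_i=\{x\in S_1:N(x)\cap S_0=\{v_{i-1},v_{i+1}\}\}$. -}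

module Defs where

open import Data.Nat using (ℕ; _≤_)
open import Data.Fin using (Fin; zero; suc)
open import Data.Bool using (Bool; true; false; if_then_else_)
open import Data.Product using (Σ; ∃; _×_; _,_)
open import Data.Sum using (_⊎_)
open import Data.Empty using (⊥)
open import Relation.Nullary using (¬_; does)
open import Relation.Binary.PropositionalEquality using (_≡_; _≢_)
open import Function.Definitions using (Injective)
open import Data.Fin using (_≟_)

record Graph (n : ℕ) : Set where
  field
    adj   : Fin n → Fin n → Bool
    sym   : ∀ u v → adj u v ≡ adj v u
    irrefl : ∀ u → adj u u ≡ false
open Graph public

data Reach {n : ℕ} (G : Graph n) : Fin n → Fin n → Set where
  here : ∀ {u} → Reach G u u
  step : ∀ {u w v} → adj G u w ≡ true → Reach G w v → Reach G u v

Connected : ∀ {n} → Graph n → Set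
Connected {n} G = ∀ (u v : Fin n) → Reach G u v

VSet : ℕ → Set
VSet n = Fin n → Bool

HasClique : ∀ {n} → Graph n → VSet n → ℕ → Set
HasClique {n} G S k =
  Σ (Fin k → Fin n) λ f →
    Injective _≡_ _≡_ f × (∀ i → S (f i) ≡ true)
    × (∀ i j → i ≢ j → adj G (f i) (f j) ≡ true)

Colorable : ∀ {n} → Graph n → VSet n → ℕ → Set
Colorable {n} G S k =
  Σ (Fin n → Fin k) λ c →
    ∀ u v → S u ≡ true → S v ≡ true → adj G u v ≡ true → c u ≢ c v

IsChromaticNumber : ∀ {n} → Graph n → VSet n → ℕ → Set
IsChromaticNumber G S χ = Colorable G S χ × (∀ k → Colorable G S k → χ ≤ k)

IsCliqueNumber : ∀ {n} → Graph n → VSet n → ℕ → Set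
IsCliqueNumber G S ω = HasClique G S ω × (∀ k → HasClique G S k → k ≤ ω)

Perfect : ∀ {n} → Graph n → Set
Perfect G = ∀ S χ ω → IsChromaticNumber G S χ → IsCliqueNumber G S ω → χ ≡ ω

Imperfect : ∀ {n} → Graph n → Set
Imperfect G = ¬ Perfect G

InducedCopy : ∀ {n k} → Graph n → (Fin k → Fin k → Bool) → (Fin k → Fin n) → Set
InducedCopy G P f = Injective _≡_ _≡_ f × (∀ i j → adj G (f i) (f j) ≡ P i j)

HasInduced : ∀ {n k} → Graph n → (Fin k → Fin k → Bool) → Set
HasInduced {n} {k} G P = Σ (Fin k → Fin n) λ f → InducedCopy G P f

K3 : Fin 3 → Fin 3 → Bool
K3 i j = if does (i ≟ j) then false else true

-- P2 ∪ P3 : vertices 0-1 (P2) and 2-3-4 (P3)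
P2∪P3 : Fin 5 → Fin 5 → Bool
P2∪P3 zero (suc zero) = true
P2∪P3 (suc zero) zero = true
P2∪P3 (suc (suc zero)) (suc (suc (suc zero))) = true
P2∪P3 (suc (suc (suc zero))) (suc (suc zero)) = true
P2∪P3 (suc (suc (suc zero))) (suc (suc (suc (suc zero)))) = true
P2∪P3 (suc (suc (suc (suc zero)))) (suc (suc (suc zero))) = true
P2∪P3 _ _ = false

next : Fin 5 → Fin 5
next zero = suc zero
next (suc zero) = suc (suc zero)
next (suc (suc zero)) = suc (suc (suc zero))
next (suc (suc (suc zero))) = suc (suc (suc (suc zero)))
next (suc (suc (suc (suc zero)))) = zero

prev : Fin 5 → Fin 5
prev zero = suc (suc (suc (suc zero)))
prev (suc zero) = zero
prev (suc (suc zero)) = suc zero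
prev (suc (suc (suc zero))) = suc (suc zero)
prev (suc (suc (suc (suc zero)))) = suc (suc (suc zero))

C5 : Fin 5 → Fin 5 → Bool
C5 i j = if does (j ≟ next i) then true else (if does (j ≟ prev i) then true else false)

-- Setup relative to an induced 5-cycle v_0..v_4 (paper's v_1..v_5, shifted).
InS0 : ∀ {n} → (Fin 5 → Fin n) → Fin n → Set
InS0 v x = ∃ λ i → x ≡ v i

InS1 : ∀ {n} → Graph n → (Fin 5 → Fin n) → Fin n → Set
InS1 G v x = ¬ InS0 v x × (∃ λ i → adj G x (v i) ≡ true)

InA : ∀ {n} → Graph n → (Fin 5 → Fin n) → Fin 5 → Fin n → Set
InA G v i x = InS1 G v x × (∀ j → (adj G x (v j) ≡ true → j ≡ i) × (j ≡ i → adj G x (v j) ≡ true))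

InB : ∀ {n} → Graph n → (Fin 5 → Fin n) → Fin 5 → Fin n → Set
InB G v i x = InS1 G v x ×
  (∀ j → (adj G x (v j) ≡ true → (j ≡ prev i ⊎ j ≡ next i))
       × ((j ≡ prev i ⊎ j ≡ next i) → adj G x (v j) ≡ true))

NonEmpty : ∀ {n} → (Fin n → Set) → Set
NonEmpty {n} P = Σ (Fin n) P

Singleton : ∀ {n} → (Fin n → Set) → Set
Singleton {n} P = Σ (Fin n) λ x → P x × (∀ y → P y → y ≡ x)

{-# OPTIONS --safe #-}
-- Let x ≠ x′ lie in B_i and y in B_{i+2}. All three see v_{i+1}, so triangle-freeness makes
-- them pairwise non-adjacent. Excluding P2 ∪ P3 against edges of the cycle forces each
-- vertex of A_j to be complete to B_{j±2} and anticomplete to B_j and A_{j+1}. In each case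
-- of the hypothesis this yields an edge anticomplete to an induced path x – c – x′, where c
-- is v_{i−1} or a vertex of A_{i+2} ∪ A_{i−2}: an induced P2 ∪ P3. The reflection of the
-- cycle exchanging v_i and v_{i+2} gives the same conclusion for B_{i+2}.
module Submission where

open import Defs
open import Data.Nat using (ℕ)
open import Data.Fin using (Fin; _≟_)
open import Data.Fin.Patterns using (0F; 1F; 2F; 3F; 4F)
open import Data.Fin.Properties using (all?)
open import Data.Bool using (Bool; true; false)
import Data.Bool.Properties as Bool
open import Data.Product as Product using (_×_; _,_; proj₁; proj₂; ∃)
open import Data.Sum as Sum using (_⊎_; inj₁; inj₂)
open import Data.Empty using (⊥; ⊥-elim)
open import Data.Vec.Functional using ([]; _∷_)
open import Function using (_∘_)
open import Function.Definitions using (Injective)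
open import Relation.Nullary using (¬_; Dec; yes; no; does)
open import Relation.Nullary.Decidable
  using (toWitness; decidable-stable; _×-dec_; _⊎-dec_; _→-dec_)
import Relation.Binary.PropositionalEquality as ≡
open ≡ using (_≡_; _≢_; refl; ≢-sym)

≡-does : ∀ {p} {P : Set p} {b : Bool} (P? : Dec P) → (b ≡ true → P) → (P → b ≡ true) → b ≡ does P?
≡-does {b = false} (yes p) _  p⇒b = p⇒b p
≡-does {b = false} (no _)  _  _   = refl
≡-does {b = true}  (yes _) _  _   = refl
≡-does {b = true}  (no ¬p) b⇒p _  = ⊥-elim (¬p (b⇒p refl))

Twins : ∀ {k} → (Fin k → Fin k → Bool) → Fin k → Fin k → Set
Twins P i j = ∀ l → P i l ≡ P j l

twins? : ∀ {k} (P : Fin k → Fin k → Bool) i j → Dec (Twins P i j)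
twins? P i j = all? λ l → P i l Bool.≟ P j l

K3-twins : ∀ i j → Twins K3 i j → i ≡ j
K3-twins = toWitness {a? = all? λ i → all? λ j → twins? K3 i j →-dec i ≟ j} _

P2∪P3-twins : ∀ i j → Twins P2∪P3 i j → i ≡ j ⊎ (i ≡ 2F × j ≡ 4F) ⊎ (i ≡ 4F × j ≡ 2F)
P2∪P3-twins = toWitness {a? = all? λ i → all? λ j →
  twins? P2∪P3 i j →-dec (i ≟ j ⊎-dec (i ≟ 2F ×-dec j ≟ 4F) ⊎-dec (i ≟ 4F ×-dec j ≟ 2F))} _

only : Fin 5 → Fin 5 → Bool
only j k = does (k ≟ j)

C5-neighbours : ∀ j k → does ((k ≟ prev j) ⊎-dec (k ≟ next j)) ≡ C5 j k
C5-neighbours = toWitness {a? = all? λ j → all? λ k →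
  does ((k ≟ prev j) ⊎-dec (k ≟ next j)) Bool.≟ C5 j k} _

Automorphism : (Fin 5 → Fin 5) → Set
Automorphism σ = (∀ a b → C5 (σ a) (σ b) ≡ C5 a b) × (∀ a b → does (σ a ≟ σ b) ≡ does (a ≟ b))

automorphism? : ∀ σ → Dec (Automorphism σ)
automorphism? σ = (all? λ a → all? λ b → C5 (σ a) (σ b) Bool.≟ C5 a b)
           ×-dec (all? λ a → all? λ b → does (σ a ≟ σ b) Bool.≟ does (a ≟ b))

-- rotate i k = i + k and reflect i k = i + 2 − k (mod 5); reflect i exchanges B_i and B_{i+2}
-- and maps the hypothesis on the A's of the theorem to itself.
rotate reflect : Fin 5 → Fin 5 → Fin 5
rotate i 0F = i
rotate i 1F = next i
rotate i 2F = next (next i)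
rotate i 3F = prev (prev i)
rotate i 4F = prev i
reflect i 0F = next (next i)
reflect i 1F = next i
reflect i 2F = i
reflect i 3F = prev i
reflect i 4F = prev (prev i)

rotate-automorphism : ∀ i → Automorphism (rotate i)
rotate-automorphism = toWitness {a? = all? (automorphism? ∘ rotate)} _

reflect-automorphism : ∀ i → Automorphism (reflect i)
reflect-automorphism = toWitness {a? = all? (automorphism? ∘ reflect)} _

module _ {n : ℕ} (H : Graph n) where

  adj-swap : ∀ {u v b} → adj H u v ≡ b → adj H v u ≡ b
  adj-swap {u} {v} uv = ≡.trans (Graph.sym H v u) uv

  same-image⇒twins : ∀ {k} {P : Fin k → Fin k → Bool} {f : Fin k → Fin n} →
                 (∀ i j → adj H (f i) (f j) ≡ P i j) → ∀ i j → f i ≡ f j → Twins P i j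
  same-image⇒twins {P = P} {f} copy i j fi≡fj l = begin
    P i l              ≡⟨ copy i l ⟨
    adj H (f i) (f l)  ≡⟨ ≡.cong (λ u → adj H u (f l)) fi≡fj ⟩
    adj H (f j) (f l)  ≡⟨ copy j l ⟩
    P j l              ∎
    where open ≡.≡-Reasoning

  triangle⇒K3 : ∀ {u v w} → adj H u v ≡ true → adj H v w ≡ true → adj H u w ≡ true →
                HasInduced H K3
  triangle⇒K3 {u} {v} {w} uv vw uw =
    f , (λ {i} {j} fi≡fj → K3-twins i j (same-image⇒twins copy i j fi≡fj)) , copy
    where
    f : Fin 3 → Fin n
    f = u ∷ v ∷ w ∷ []
    copy : ∀ i j → adj H (f i) (f j) ≡ K3 i j
    copy 0F 0F = irrefl H u
    copy 0F 1F = uv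
    copy 0F 2F = uw
    copy 1F 0F = adj-swap uv
    copy 1F 1F = irrefl H v
    copy 1F 2F = vw
    copy 2F 0F = adj-swap uw
    copy 2F 1F = adj-swap vw
    copy 2F 2F = irrefl H w

  module TriangleFree (no-K3 : ¬ HasInduced H K3) where

    common-neighbour⇒non-adjacent : ∀ {u v w} → adj H u w ≡ true → adj H v w ≡ true →
                                    adj H u v ≡ false
    common-neighbour⇒non-adjacent uw vw =
      Bool.¬-not λ uv → no-K3 (triangle⇒K3 uv vw uw)

  module P2∪P3Free (no-P2∪P3 : ¬ HasInduced H P2∪P3) where

    no-edge-anticomplete-to-P3 : ∀ d e a b c → adj H d e ≡ true →
      adj H a b ≡ true → adj H b c ≡ true → adj H a c ≡ false → a ≢ c →
      adj H d a ≡ false → adj H d b ≡ false → adj H d c ≡ false →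
      adj H e a ≡ false → adj H e b ≡ false → adj H e c ≡ false → ⊥
    no-edge-anticomplete-to-P3 d e a b c de ab bc ac a≢c da db dc ea eb ec =
      no-P2∪P3 (f , injective , copy)
      where
      f : Fin 5 → Fin n
      f = d ∷ e ∷ a ∷ b ∷ c ∷ []
      copy : ∀ i j → adj H (f i) (f j) ≡ P2∪P3 i j
      copy 0F 0F = irrefl H d
      copy 0F 1F = de
      copy 0F 2F = da
      copy 0F 3F = db
      copy 0F 4F = dc
      copy 1F 0F = adj-swap de
      copy 1F 1F = irrefl H e
      copy 1F 2F = ea
      copy 1F 3F = eb
      copy 1F 4F = ec
      copy 2F 0F = adj-swap da
      copy 2F 1F = adj-swap ea
      copy 2F 2F = irrefl H a
      copy 2F 3F = ab
      copy 2F 4F = ac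
      copy 3F 0F = adj-swap db
      copy 3F 1F = adj-swap eb
      copy 3F 2F = adj-swap ab
      copy 3F 3F = irrefl H b
      copy 3F 4F = bc
      copy 4F 0F = adj-swap dc
      copy 4F 1F = adj-swap ec
      copy 4F 2F = adj-swap ac
      copy 4F 3F = adj-swap bc
      copy 4F 4F = irrefl H c
      injective : Injective _≡_ _≡_ f
      injective {i} {j} fi≡fj with P2∪P3-twins i j (same-image⇒twins copy i j fi≡fj)
      ... | inj₁ i≡j                = i≡j
      ... | inj₂ (inj₁ (refl , refl)) = ⊥-elim (a≢c fi≡fj)
      ... | inj₂ (inj₂ (refl , refl)) = ⊥-elim (a≢c (≡.sym fi≡fj))

  InducedC5 : (Fin 5 → Fin n) → Set
  InducedC5 w = ∀ a b → adj H (w a) (w b) ≡ C5 a b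

  record Attached (w : Fin 5 → Fin n) (S : Fin 5 → Bool) (x : Fin n) : Set where
    field
      off-cycle : ∀ k → x ≢ w k
      trace     : ∀ k → adj H x (w k) ≡ S k

    trace˘ : ∀ k → adj H (w k) x ≡ S k
    trace˘ k = adj-swap (trace k)

  open Attached public

  A B : (Fin 5 → Fin n) → Fin 5 → Fin n → Set
  A w j = Attached w (only j)
  B w j = Attached w (C5 j)

  InA⇒A : ∀ {v j x} → InA H v j x → A v j x
  InA⇒A {j = j} ((x∉S₀ , _) , neighbours) = record
    { off-cycle = λ k x≡vk → x∉S₀ (k , x≡vk)
    ; trace     = λ k → ≡-does (k ≟ j) (proj₁ (neighbours k)) (proj₂ (neighbours k))
    }

  InB⇒B : ∀ {v j x} → InB H v j x → B v j x
  InB⇒B {j = j} ((x∉S₀ , _) , neighbours) = record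
    { off-cycle = λ k x≡vk → x∉S₀ (k , x≡vk)
    ; trace     = λ k → ≡.trans (≡-does ((k ≟ prev j) ⊎-dec (k ≟ next j))
                                   (proj₁ (neighbours k)) (proj₂ (neighbours k)))
                                 (C5-neighbours j k)
    }

  module _ {σ : Fin 5 → Fin 5} (σ-aut : Automorphism σ) where

    induced-C5-∘ : ∀ {w} → InducedC5 w → InducedC5 (w ∘ σ)
    induced-C5-∘ C5-w a b = ≡.trans (C5-w (σ a) (σ b)) (proj₁ σ-aut a b)

    attached-∘ : ∀ {w S S′ x} → (∀ k → S (σ k) ≡ S′ k) → Attached w S x → Attached (w ∘ σ) S′ x
    attached-∘ S∘σ≗S′ x∈ = record
      { off-cycle = off-cycle x∈ ∘ σ
      ; trace     = λ k → ≡.trans (trace x∈ (σ k)) (S∘σ≗S′ k)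
      }

    A-∘ : ∀ {w x} j → A w (σ j) x → A (w ∘ σ) j x
    A-∘ j = attached-∘ λ k → proj₂ σ-aut k j

    B-∘ : ∀ {w x} j → B w (σ j) x → B (w ∘ σ) j x
    B-∘ j = attached-∘ (proj₁ σ-aut j)

    pendant-∘ : ∀ {v} j → NonEmpty (InA H v (σ j)) → ∃ (A (v ∘ σ) j)
    pendant-∘ j (a , a∈) = a , A-∘ j (InA⇒A a∈)

  rotated : ∀ {w} → InducedC5 w → ∀ j → InducedC5 (w ∘ rotate j)
  rotated C5-w j = induced-C5-∘ (rotate-automorphism j) C5-w

  PendantCondition : (Fin 5 → Fin n) → Set
  PendantCondition w = (∃ (A w 0F) ⊎ ∃ (A w 2F)) ⊎ (∃ (A w 3F) × ∃ (A w 4F))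

  module _ (no-K3 : ¬ HasInduced H K3) (no-P2∪P3 : ¬ HasInduced H P2∪P3) where
    open TriangleFree no-K3
    open P2∪P3Free no-P2∪P3

    module AtVertex₀ {w : Fin 5 → Fin n} (C5-w : InducedC5 w) {a : Fin n} (a∈A₀ : A w 0F a) where

      A₀-anticomplete : ∀ {S u} → Attached w S u → S 0F ≡ false → S 2F ≡ false → S 3F ≡ false →
                        adj H a u ≡ false
      A₀-anticomplete {u = u} u∈ S₀ S₂ S₃ = Bool.¬-not λ a~u →
        no-edge-anticomplete-to-P3 (w 2F) (w 3F) (w 0F) a u
          (C5-w 2F 3F) (trace˘ a∈A₀ 0F) a~u (≡.trans (trace˘ u∈ 0F) S₀) (≢-sym (off-cycle u∈ 0F))
          (C5-w 2F 0F) (trace˘ a∈A₀ 2F) (≡.trans (trace˘ u∈ 2F) S₂)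
          (C5-w 3F 0F) (trace˘ a∈A₀ 3F) (≡.trans (trace˘ u∈ 3F) S₃)

      A₀-complete-B₂ : ∀ {u} → B w 2F u → adj H a u ≡ true
      A₀-complete-B₂ {u} u∈B₂ = Bool.¬-not λ a≁u →
        no-edge-anticomplete-to-P3 (w 0F) a (w 2F) (w 3F) u
          (trace˘ a∈A₀ 0F) (C5-w 2F 3F) (trace˘ u∈B₂ 3F) (trace˘ u∈B₂ 2F) (≢-sym (off-cycle u∈B₂ 2F))
          (C5-w 0F 2F) (C5-w 0F 3F) (trace˘ u∈B₂ 0F)
          (trace a∈A₀ 2F) (trace a∈A₀ 3F) a≁u

      A₀-complete-B₃ : ∀ {u} → B w 3F u → adj H a u ≡ true
      A₀-complete-B₃ {u} u∈B₃ = Bool.¬-not λ a≁u →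
        no-edge-anticomplete-to-P3 (w 0F) a (w 3F) (w 2F) u
          (trace˘ a∈A₀ 0F) (C5-w 3F 2F) (trace˘ u∈B₃ 2F) (trace˘ u∈B₃ 3F) (≢-sym (off-cycle u∈B₃ 3F))
          (C5-w 0F 3F) (C5-w 0F 2F) (trace˘ u∈B₃ 0F)
          (trace a∈A₀ 3F) (trace a∈A₀ 2F) a≁u

    module _ {w : Fin 5 → Fin n} (C5-w : InducedC5 w)
             (j : Fin 5) {a u : Fin n} (a∈Aⱼ : A w j a) where
      open AtVertex₀ (rotated C5-w j) (A-∘ (rotate-automorphism j) 0F a∈Aⱼ)

      A-anticomplete-B : B w j u → adj H a u ≡ false
      A-anticomplete-B u∈Bⱼ =
        A₀-anticomplete (B-∘ (rotate-automorphism j) 0F u∈Bⱼ) refl refl refl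

      A-anticomplete-A₊₁ : A w (next j) u → adj H a u ≡ false
      A-anticomplete-A₊₁ u∈Aⱼ₊₁ =
        A₀-anticomplete (A-∘ (rotate-automorphism j) 1F u∈Aⱼ₊₁) refl refl refl

      A-complete-B₊₂ : B w (next (next j)) u → adj H a u ≡ true
      A-complete-B₊₂ u∈Bⱼ₊₂ = A₀-complete-B₂ (B-∘ (rotate-automorphism j) 2F u∈Bⱼ₊₂)

      A-complete-B₋₂ : B w (prev (prev j)) u → adj H a u ≡ true
      A-complete-B₋₂ u∈Bⱼ₋₂ = A₀-complete-B₃ (B-∘ (rotate-automorphism j) 3F u∈Bⱼ₋₂)

    module _ {w : Fin 5 → Fin n} (C5-w : InducedC5 w)
             {x x′ y : Fin n} (x∈B₀ : B w 0F x) (x′∈B₀ : B w 0F x′) (y∈B₂ : B w 2F y) where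
      private
        x≁x′ : adj H x x′ ≡ false
        x≁x′ = common-neighbour⇒non-adjacent (trace x∈B₀ 1F) (trace x′∈B₀ 1F)
        y≁x : adj H y x ≡ false
        y≁x = common-neighbour⇒non-adjacent (trace y∈B₂ 1F) (trace x∈B₀ 1F)
        y≁x′ : adj H y x′ ≡ false
        y≁x′ = common-neighbour⇒non-adjacent (trace y∈B₂ 1F) (trace x′∈B₀ 1F)

      B₀-subsingleton-by-A₀ : ∀ {a} → A w 0F a → x ≡ x′
      B₀-subsingleton-by-A₀ {a} a∈A₀ = decidable-stable (x ≟ x′) λ x≢x′ →
        no-edge-anticomplete-to-P3 a y x (w 4F) x′
          (A-complete-B₊₂ C5-w 0F a∈A₀ y∈B₂) (trace x∈B₀ 4F) (trace˘ x′∈B₀ 4F) x≁x′ x≢x′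
          (A-anticomplete-B C5-w 0F a∈A₀ x∈B₀) (trace a∈A₀ 4F) (A-anticomplete-B C5-w 0F a∈A₀ x′∈B₀)
          y≁x (trace y∈B₂ 4F) y≁x′

      B₀-subsingleton-by-A₂ : ∀ {a} → A w 2F a → x ≡ x′
      B₀-subsingleton-by-A₂ {a} a∈A₂ = decidable-stable (x ≟ x′) λ x≢x′ →
        no-edge-anticomplete-to-P3 (w 3F) y x a x′
          (trace˘ y∈B₂ 3F)
          (adj-swap (A-complete-B₋₂ C5-w 2F a∈A₂ x∈B₀)) (A-complete-B₋₂ C5-w 2F a∈A₂ x′∈B₀) x≁x′ x≢x′
          (trace˘ x∈B₀ 3F) (trace˘ a∈A₂ 3F) (trace˘ x′∈B₀ 3F)
          y≁x (adj-swap (A-anticomplete-B C5-w 2F a∈A₂ y∈B₂)) y≁x′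

      B₀-subsingleton-by-A₃A₄ : ∀ {a b} → A w 3F a → A w 4F b → x ≡ x′
      B₀-subsingleton-by-A₃A₄ {a} {b} a∈A₃ b∈A₄ = decidable-stable (x ≟ x′) λ x≢x′ →
        no-edge-anticomplete-to-P3 y b x a x′
          (adj-swap (A-complete-B₋₂ C5-w 4F b∈A₄ y∈B₂))
          (adj-swap (A-complete-B₊₂ C5-w 3F a∈A₃ x∈B₀)) (A-complete-B₊₂ C5-w 3F a∈A₃ x′∈B₀) x≁x′ x≢x′
          y≁x (common-neighbour⇒non-adjacent (trace y∈B₂ 3F) (trace a∈A₃ 3F)) y≁x′
          (common-neighbour⇒non-adjacent (trace b∈A₄ 4F) (trace x∈B₀ 4F))
          (adj-swap (A-anticomplete-A₊₁ C5-w 3F a∈A₃ b∈A₄))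
          (common-neighbour⇒non-adjacent (trace b∈A₄ 4F) (trace x′∈B₀ 4F))

    B₀-subsingleton : ∀ {w x x′} → InducedC5 w → PendantCondition w → ∃ (B w 2F) →
                      B w 0F x → B w 0F x′ → x ≡ x′
    B₀-subsingleton C5-w (inj₁ (inj₁ (_ , a∈A₀))) (_ , y∈B₂) x∈B₀ x′∈B₀ =
      B₀-subsingleton-by-A₀ C5-w x∈B₀ x′∈B₀ y∈B₂ a∈A₀
    B₀-subsingleton C5-w (inj₁ (inj₂ (_ , a∈A₂))) (_ , y∈B₂) x∈B₀ x′∈B₀ =
      B₀-subsingleton-by-A₂ C5-w x∈B₀ x′∈B₀ y∈B₂ a∈A₂
    B₀-subsingleton C5-w (inj₂ ((_ , a∈A₃) , (_ , b∈A₄))) (_ , y∈B₂) x∈B₀ x′∈B₀ =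
      B₀-subsingleton-by-A₃A₄ C5-w x∈B₀ x′∈B₀ y∈B₂ a∈A₃ b∈A₄

    B-subsingleton-in-frame : ∀ {v σ x x′} → InducedC5 v → Automorphism σ →
      PendantCondition (v ∘ σ) → NonEmpty (InB H v (σ 2F)) →
      InB H v (σ 0F) x → InB H v (σ 0F) x′ → x ≡ x′
    B-subsingleton-in-frame C5-v σ-aut pendants (_ , y∈) x∈ x′∈ =
      B₀-subsingleton (induced-C5-∘ σ-aut C5-v) pendants (_ , B-∘ σ-aut 2F (InB⇒B y∈))
        (B-∘ σ-aut 0F (InB⇒B x∈)) (B-∘ σ-aut 0F (InB⇒B x′∈))

lemma3p6 : ∀ {n : ℕ} (H : Graph n) → Connected H → Imperfect H
    → ¬ HasInduced H K3 → ¬ HasInduced H P2∪P3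
    → (v : Fin 5 → Fin n) → InducedCopy H C5 v
    → (i : Fin 5)
    → NonEmpty (InB H v i) → NonEmpty (InB H v (next (next i)))
    → (NonEmpty (InA H v i) ⊎ NonEmpty (InA H v (next (next i))))
      ⊎ (NonEmpty (InA H v (prev (prev i))) × NonEmpty (InA H v (prev i)))
    → Singleton (InB H v i) × Singleton (InB H v (next (next i)))
lemma3p6 H _ _ no-K3 no-P2∪P3 v (_ , C5-v) i (x , x∈Bᵢ) (y , y∈Bᵢ₊₂) pendants =
    (x , x∈Bᵢ , λ x′ x′∈Bᵢ →
      B-subsingleton-in-frame H no-K3 no-P2∪P3 C5-v ρ rotated-pendants (y , y∈Bᵢ₊₂) x′∈Bᵢ x∈Bᵢ)
  , (y , y∈Bᵢ₊₂ , λ y′ y′∈Bᵢ₊₂ →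
      B-subsingleton-in-frame H no-K3 no-P2∪P3 C5-v τ reflected-pendants (x , x∈Bᵢ) y′∈Bᵢ₊₂ y∈Bᵢ₊₂)
  where
  ρ : Automorphism (rotate i)
  ρ = rotate-automorphism i
  τ : Automorphism (reflect i)
  τ = reflect-automorphism i
  rotated-pendants : PendantCondition H (v ∘ rotate i)
  rotated-pendants =
    Sum.map (Sum.map (pendant-∘ H ρ 0F) (pendant-∘ H ρ 2F))
            (Product.map (pendant-∘ H ρ 3F) (pendant-∘ H ρ 4F)) pendants
  reflected-pendants : PendantCondition H (v ∘ reflect i)
  reflected-pendants =
    Sum.map (Sum.swap ∘ Sum.map (pendant-∘ H τ 2F) (pendant-∘ H τ 0F))
            (Product.swap ∘ Product.map (pendant-∘ H τ 4F) (pendant-∘ H τ 3F)) pendants
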